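{- Let $A$, $X$ and $B$ be FDDS, let $\alpha$ be the number of unroll trees of $\mathcal{U}(B)$, and let $n\ge 2\alpha+\mathrm{depth}(\mathcal{U}(B))$. Then $\mathcal{U}(A)\,\mathcal{U}(X)=\mathcal{U}(B)$ if and only if $[\mathcal{U}(A)]_n\,[\mathcal{U}(X)]_n=[\mathcal{U}(B)]_n$.
   Context: A finite discrete-time dynamical system (FDDS) is a pair $(S,f)$ with $S$ a finite set and $f:S\to S$, identified with its transition digraph and considered up to isomorphism. A state is periodic if it lies on a cycle. The depth of an FDDS is the maximum over states $s$ of the least $t\ge0$ with $f^t(s)$ periodic. For a periodic state $u$, the unroll tree in $u$ is the infinite rooted tree with vertex set $\{(s,k)\mid k\in\mathbb{N},\ f^k(s)=u\}$, root $(u,0)$ and arcs $(v,k)\to(f(v),k-1)$. The unroll $\mathcal{U}(A)$ is the multiset of unroll trees of $A$ (one per periodic state), and $\mathrm{depth}(\mathcal{U}(A))$ is the depth of $A$. The depth of a node of a rooted tree is its distance to the root. The product of rooted trees $\mathbf{t}_1=(V_1,E_1)$, $\mathbf{t}_2=(V_2,E_2)$ has vertex set $\{(v,u)\in V_1\times V_2\mid\mathrm{depth}(v)=\mathrm{depth}(u)\}$ and arcs $((v,u),(v',u'))$ whenever $(v,v')\in E_1$, $(u,u')\in E_2$; the product of multisets of trees is the multiset of pairwise products. For a tree $\mathbf{t}$, $[\mathbf{t}]_n$ is the induced subtree on vertices of depth at most $n$; for a multiset of trees it is applied to each tree. Equality means isomorphism. -}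

module Defs where

open import Data.Nat using (ℕ; zero; suc; _+_; _*_; _≤_; _⊔_)
open import Data.Fin using (Fin; toℕ)
open import Data.Fin.Properties using (_≟_)
open import Data.Bool using (Bool; true; false; if_then_else_; T)
open import Data.List using (List; map; foldr)
open import Data.Bool.ListAction using (any)
open import Data.Nat.ListAction using (sum)
open import Data.List.Base using (allFin)
open import Data.Product using (Σ; _×_; _,_; proj₁; proj₂)
open import Relation.Nullary.Decidable using (⌊_⌋)
open import Relation.Binary.PropositionalEquality using (_≡_)
open import Function.Bundles using (_↔_; _⇔_; Inverse)

record FDDS : Set where
  constructor fdds
  field
    size : ℕ
    f    : Fin size → Fin size

open FDDS public

iter : ∀ {m} → (Fin m → Fin m) → ℕ → Fin m → Fin m
iter g zero    s = s
iter g (suc k) s = g (iter g k s)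

-- u is periodic iff f^p(u) = u for some p ≥ 1.  Since a cycle of an FDDS
-- on m states has length ≤ m, it suffices to search p ∈ {1,…,m}; this
-- gives a decidable (Boolean) predicate, so that the set of periodic
-- states is a genuine subset of the states.
isPeriodic : (A : FDDS) → Fin (size A) → Bool
isPeriodic A u = any (λ p → ⌊ iter (f A) (suc (toℕ p)) u ≟ u ⌋) (allFin (size A))

PeriodicState : FDDS → Set
PeriodicState A = Σ (Fin (size A)) (λ u → T (isPeriodic A u))

-- least t with f^t(s) periodic (search with fuel = number of states,
-- which always suffices since the transient part has < size states)
leastPer : (A : FDDS) → ℕ → Fin (size A) → ℕ
leastPer A zero    s = zero
leastPer A (suc fuel) s =
  if isPeriodic A s then zero else suc (leastPer A fuel (f A s))

-- depth of an FDDS = depth of its unroll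
depth : FDDS → ℕ
depth A = foldr _⊔_ 0 (map (leastPer A (size A)) (allFin (size A)))

-- number of periodic states = number of trees in the unroll
numPeriodic : FDDS → ℕ
numPeriodic A = sum (map (λ u → if isPeriodic A u then 1 else 0) (allFin (size A)))

record RTree : Set₁ where
  field
    V         : Set
    root      : V
    arc       : V → V → Set
    dep       : V → ℕ
    rootDepth : dep root ≡ 0

open RTree public

unrollTree : (A : FDDS) → Fin (size A) → RTree
unrollTree A u = record
  { V         = Σ (Fin (size A) × ℕ) (λ sk → iter (f A) (proj₂ sk) (proj₁ sk) ≡ u)
  ; root      = (u , 0) , Relation.Binary.PropositionalEquality.refl
  ; arc       = λ x y → (f A (proj₁ (proj₁ x)) ≡ proj₁ (proj₁ y))
                        × (proj₂ (proj₁ x) ≡ suc (proj₂ (proj₁ y)))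
  ; dep       = λ x → proj₂ (proj₁ x)
  ; rootDepth = Relation.Binary.PropositionalEquality.refl
  }

_⊗ᵗ_ : RTree → RTree → RTree
t₁ ⊗ᵗ t₂ = record
  { V         = Σ (V t₁ × V t₂) (λ p → dep t₁ (proj₁ p) ≡ dep t₂ (proj₂ p))
  ; root      = (root t₁ , root t₂)
                , Relation.Binary.PropositionalEquality.trans (rootDepth t₁)
                    (Relation.Binary.PropositionalEquality.sym (rootDepth t₂))
  ; arc       = λ x y → arc t₁ (proj₁ (proj₁ x)) (proj₁ (proj₁ y))
                        × arc t₂ (proj₂ (proj₁ x)) (proj₂ (proj₁ y))
  ; dep       = λ x → dep t₁ (proj₁ (proj₁ x))
  ; rootDepth = rootDepth t₁
  }

truncᵗ : ℕ → RTree → RTree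
truncᵗ n t = record
  { V         = Σ (V t) (λ v → dep t v ≤ n)
  ; root      = root t , Relation.Binary.PropositionalEquality.subst (_≤ n)
                  (Relation.Binary.PropositionalEquality.sym (rootDepth t)) Data.Nat.z≤n
  ; arc       = λ x y → arc t (proj₁ x) (proj₁ y)
  ; dep       = λ x → dep t (proj₁ x)
  ; rootDepth = rootDepth t
  }

record _≅ᵗ_ (t₁ t₂ : RTree) : Set where
  field
    bij      : V t₁ ↔ V t₂
    rootPres : Inverse.to bij (root t₁) ≡ root t₂
    arcPres  : ∀ x y → arc t₁ x y ⇔ arc t₂ (Inverse.to bij x) (Inverse.to bij y)

-- Multisets of trees (families indexed by a type)

record MTree : Set₁ where
  field
    Idx  : Set
    tree : Idx → RTree

open MTree public

unroll : FDDS → MTree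
unroll A = record { Idx = PeriodicState A ; tree = λ u → unrollTree A (proj₁ u) }

_⊗_ : MTree → MTree → MTree
M ⊗ N = record { Idx = Idx M × Idx N
               ; tree = λ ij → tree M (proj₁ ij) ⊗ᵗ tree N (proj₂ ij) }

trunc : ℕ → MTree → MTree
trunc n M = record { Idx = Idx M ; tree = λ i → truncᵗ n (tree M i) }

infix 4 _≃_
infixl 7 _⊗_
_≃_ : MTree → MTree → Set
M ≃ N = Σ (Idx M ↔ Idx N) (λ σ → ∀ i → tree M i ≅ᵗ tree N (Inverse.to σ i))

-- Truncating an isomorphism of unrolls is immediate; the content is the converse. An isomorphism of
-- unroll trees is the same as a family of bijections between the levels f⁻ᵏ(u) commuting with f. The
-- unroll tree of a periodic state u of period P consists of a spine, whose node on level k is the unique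
-- periodic state there, and of the branches hanging from the spine; the branch at spine position j
-- depends only on j mod P, and in B every branch has height less than depth(B). Since the orbit of a pair
-- (a, x) of periodic states is mapped injectively into the periodic states of B, the periods P of (a, x)
-- and P' of the corresponding b are at most α. An isomorphism of the levels ≤ n maps spine to spine and,
-- as n ≥ P + P' + depth(B), identifies the branches at the first P + P' spine positions. By the theorem
-- of Fine and Wilf the two periodic sequences of branches then agree everywhere, and gluing the branch
-- isomorphisms along the spines gives an isomorphism of the full unroll trees.

module Submission where

open import Defs
open import Axiom.UniquenessOfIdentityProofs.WithK using (uip)
open import Data.Bool using (Bool; true; false; T; if_then_else_)
open import Data.Bool.Properties using (T-irrelevant)
open import Data.Empty using (⊥; ⊥-elim)
open import Data.Fin using (Fin; toℕ) renaming (zero to fzero; suc to fsuc)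
import Data.Fin.Properties as Fin
open import Data.List using (List; _∷_; foldr; tabulate; allFin)
open import Data.List.Membership.Propositional using (_∈_)
open import Data.List.Membership.Propositional.Properties using (∈-allFin; ∈-map⁺)
open import Data.List.Properties using (map-tabulate)
open import Data.List.Relation.Unary.Any as Any using (here; there)
open import Data.List.Relation.Unary.Any.Properties using (any⁺; any⁻)
open import Data.Nat using (ℕ; zero; suc; _+_; _*_; _∸_; _≤_; _<_; z≤n; s≤s; _⊔_; _<?_)
open import Data.Nat.Induction using (<-rec)
open import Data.Nat.ListAction using (sum)
open import Data.Nat.Properties
open import Data.Nat.Tactic.RingSolver using (solve-∀)
open import Data.Product using (Σ; Σ-syntax; ∃-syntax; _×_; _,_; proj₁; proj₂)
open import Data.Product.Properties using (≡-dec)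
open import Data.Unit using (⊤; tt)
open import Function.Base using (_∘_; _∘′_; id)
open import Function.Bundles using (_⇔_; _↔_; Inverse; mk↔ₛ′; mk⇔; Equivalence)
open import Relation.Binary.Definitions using (DecidableEquality; tri<; tri≈; tri>)
open import Relation.Binary.PropositionalEquality
open import Relation.Nullary using (Dec; yes; no)
open import Relation.Nullary.Decidable using (False; toWitness; fromWitness; toWitnessFalse; fromWitnessFalse)

infixr 8 _^_

_^_ : {S : Set} → (S → S) → ℕ → S → S
(g ^ zero)  s = s
(g ^ suc k) s = g ((g ^ k) s)

iter≡^ : ∀ {m} (h : Fin m → Fin m) k s → iter h k s ≡ (h ^ k) s
iter≡^ h zero    s = refl
iter≡^ h (suc k) s = cong h (iter≡^ h k s)

module _ {S : Set} (g : S → S) where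

  ^-+ : ∀ m n s → (g ^ (m + n)) s ≡ (g ^ m) ((g ^ n) s)
  ^-+ zero    n s = refl
  ^-+ (suc m) n s = cong g (^-+ m n s)

  ^-step : ∀ k s → (g ^ k) (g s) ≡ g ((g ^ k) s)
  ^-step zero    s = refl
  ^-step (suc k) s = cong g (^-step k s)

  ^-comm : ∀ m n s → (g ^ m) ((g ^ n) s) ≡ (g ^ n) ((g ^ m) s)
  ^-comm m n s = begin
    (g ^ m) ((g ^ n) s)  ≡⟨ ^-+ m n s ⟨
    (g ^ (m + n)) s      ≡⟨ cong (λ k → (g ^ k) s) (+-comm m n) ⟩
    (g ^ (n + m)) s      ≡⟨ ^-+ n m s ⟩
    (g ^ n) ((g ^ m) s)  ∎
    where open ≡-Reasoning

  ^-*-fixed : ∀ p {s} → (g ^ p) s ≡ s → ∀ k → (g ^ (k * p)) s ≡ s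
  ^-*-fixed p fix zero    = refl
  ^-*-fixed p {s} fix (suc k) = trans (^-+ p (k * p) s) (trans (cong (g ^ p) (^-*-fixed p fix k)) fix)

Periodic : {S : Set} → (S → S) → S → Set
Periodic g w = ∃[ r ] (g ^ suc r) w ≡ w

commonPeriod : ∀ {S S' : Set} (g : S → S) (g' : S' → S') {w w'} →
               Periodic g w → Periodic g' w' → ∃[ M ] (g ^ suc M) w ≡ w × (g' ^ suc M) w' ≡ w'
commonPeriod g g' {w} (r , e) (r' , e') =
  r' + r * suc r' ,
  trans (cong (λ k → (g ^ k) w) (*-comm (suc r) (suc r'))) (^-*-fixed g (suc r) e (suc r')) ,
  ^-*-fixed g' (suc r') e' (suc r)

module _ {S : Set} (g : S → S) where

  Periodic-^ : ∀ {w} → Periodic g w → ∀ k → Periodic g ((g ^ k) w)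
  Periodic-^ {w} (r , e) k = r , trans (^-comm g (suc r) k w) (cong (g ^ k) e)

  Periodic-injective : ∀ k {w w'} → Periodic g w → Periodic g w' → (g ^ k) w ≡ (g ^ k) w' → w ≡ w'
  Periodic-injective zero    pw pw' eq = eq
  Periodic-injective (suc k) pw pw' eq = Periodic-injective k pw pw' (cancel (Periodic-^ pw k) (Periodic-^ pw' k) eq)
    where
      cancel : ∀ {v v'} → Periodic g v → Periodic g v' → g v ≡ g v' → v ≡ v'
      cancel {v} {v'} pv pv' gv≡gv' = let M , fix , fix' = commonPeriod g g pv pv' in begin
        v                    ≡⟨ fix ⟨
        g ((g ^ M) v)        ≡⟨ ^-step g M v ⟨
        (g ^ M) (g v)        ≡⟨ cong (g ^ M) gv≡gv' ⟩
        (g ^ M) (g v')       ≡⟨ ^-step g M v' ⟩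
        g ((g ^ M) v')       ≡⟨ fix' ⟩
        v'                   ∎
        where open ≡-Reasoning

  -- Pigeonhole on the codes of w, g w, …, gᵅ w yields gⁱ w ≡ gʲ w with i < j ≤ α,
  -- and cancelling gⁱ on the cycle leaves g^(j-i) w ≡ w.
  period≤ : ∀ {w α} → Periodic g w → (code : ℕ → Fin α) →
            (∀ i j → code i ≡ code j → (g ^ i) w ≡ (g ^ j) w) →
            Σ[ per ∈ Periodic g w ] suc (proj₁ per) ≤ α
  period≤ {w} {α} pw code faithful =
    let i , j , i<j , same = Fin.pigeonhole (n<1+n α) (code ∘ toℕ)
        d , i+d≡j = m≤n⇒∃[o]m+o≡n i<j
        ti = toℕ i
        shift : (g ^ ti) ((g ^ suc d) w) ≡ (g ^ ti) w
        shift = trans (sym (^-+ g ti (suc d) w))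
                  (trans (cong (λ k → (g ^ k) w) (trans (+-suc ti d) i+d≡j))
                         (sym (faithful ti (toℕ j) same)))
    in (d , Periodic-injective ti (Periodic-^ pw (suc d)) pw shift) ,
       ≤-trans (≤-trans (m≤n+m (suc d) ti) (≤-reflexive (trans (+-suc ti d) i+d≡j))) (≤-pred (Fin.toℕ<n j))

≤-foldr-⊔ : ∀ {x} (xs : List ℕ) → x ∈ xs → x ≤ foldr _⊔_ 0 xs
≤-foldr-⊔ (y ∷ xs) (here refl) = m≤m⊔n y _
≤-foldr-⊔ (y ∷ xs) (there x∈xs) = ≤-trans (≤-foldr-⊔ xs x∈xs) (m≤n⊔m y _)

module _ (A : FDDS) where

  private
    m = size A
    h = f A

  isPeriodic⇒witness : ∀ {u} → T (isPeriodic A u) → ∃[ q ] iter h (suc (toℕ q)) u ≡ u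
  isPeriodic⇒witness {u} t = let q , w = Any.satisfied (any⁻ _ (allFin m) t) in q , toWitness w

  witness⇒isPeriodic : ∀ {u} (q : Fin m) → iter h (suc (toℕ q)) u ≡ u → T (isPeriodic A u)
  witness⇒isPeriodic q e = any⁺ _ (Any.map (λ { refl → fromWitness e }) (∈-allFin q))

  isPeriodic⇒Periodic : ∀ {u} → T (isPeriodic A u) → Periodic h u
  isPeriodic⇒Periodic {u} t = let q , e = isPeriodic⇒witness t in toℕ q , trans (sym (iter≡^ h (suc (toℕ q)) u)) e

  isPeriodic-^ : ∀ {u} → T (isPeriodic A u) → ∀ k → T (isPeriodic A ((h ^ k) u))
  isPeriodic-^ {u} t k = let q , e = isPeriodic⇒witness t ; r = suc (toℕ q) in
    witness⇒isPeriodic q (begin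
      iter h r ((h ^ k) u)   ≡⟨ iter≡^ h r _ ⟩
      (h ^ r) ((h ^ k) u)    ≡⟨ ^-comm h r k u ⟩
      (h ^ k) ((h ^ r) u)    ≡⟨ cong (h ^ k) (trans (sym (iter≡^ h r u)) e) ⟩
      (h ^ k) u              ∎)
    where open ≡-Reasoning

  Periodic-after-size : ∀ s → Periodic h ((h ^ m) s)
  Periodic-after-size s =
    let i , j , i<j , same = Fin.pigeonhole (n<1+n m) (λ i → (h ^ toℕ i) s)
        d , i+d≡j = m≤n⇒∃[o]m+o≡n i<j
        w-periodic : Periodic h ((h ^ toℕ i) s)
        w-periodic = d , trans (sym (^-+ h (suc d) (toℕ i) s))
                           (trans (cong (λ k → (h ^ k) s) (trans (cong suc (+-comm d (toℕ i))) i+d≡j)) (sym same))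
        i+[m∸i]≡m = trans (sym (^-+ h (m ∸ toℕ i) (toℕ i) s))
                      (cong (λ k → (h ^ k) s) (m∸n+n≡m (≤-pred (Fin.toℕ<n i))))
    in subst (Periodic h) i+[m∸i]≡m (Periodic-^ h w-periodic (m ∸ toℕ i))

  leastPer-Periodic : ∀ fuel s → Periodic h ((h ^ fuel) s) → Periodic h ((h ^ leastPer A fuel s) s)
  leastPer-Periodic zero       s p = p
  leastPer-Periodic (suc fuel) s p with isPeriodic A s in eq
  ... | true  = isPeriodic⇒Periodic (subst T (sym eq) tt)
  ... | false = subst (Periodic h) (^-step h (leastPer A fuel (h s)) s)
                  (leastPer-Periodic fuel (h s) (subst (Periodic h) (sym (^-step h fuel s)) p))

  Periodic-after-depth : ∀ s → Periodic h ((h ^ depth A) s)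
  Periodic-after-depth s =
    let l = leastPer A m s
        d , l+d≡depth = m≤n⇒∃[o]m+o≡n (≤-foldr-⊔ _ (∈-map⁺ (leastPer A m) (∈-allFin s)))
    in subst (Periodic h) (trans (sym (^-+ h d l s)) (cong (λ k → (h ^ k) s) (trans (+-comm d l) l+d≡depth)))
         (Periodic-^ h (leastPer-Periodic m s (Periodic-after-size s)) d)

count : ∀ m → (Fin m → Bool) → ℕ
count m P = sum (tabulate λ u → if P u then 1 else 0)

rank : ∀ m (P : Fin m → Bool) x → T (P x) → Fin (count m P)
rank (suc m) P fzero    t with P fzero
... | true = fzero
rank (suc m) P (fsuc x) t with P fzero
... | true  = fsuc (rank m (P ∘ fsuc) x t)
... | false = rank m (P ∘ fsuc) x t

rank-injective : ∀ m (P : Fin m → Bool) x y tx ty → rank m P x tx ≡ rank m P y ty → x ≡ y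
rank-injective (suc m) P fzero    fzero    tx ty eq = refl
rank-injective (suc m) P fzero    (fsuc y) tx ty eq with P fzero
rank-injective (suc m) P fzero    (fsuc y) tx ty () | true
rank-injective (suc m) P (fsuc x) fzero    tx ty eq with P fzero
rank-injective (suc m) P (fsuc x) fzero    tx ty () | true
rank-injective (suc m) P (fsuc x) (fsuc y) tx ty eq with P fzero
... | true  = cong fsuc (rank-injective m (P ∘ fsuc) x y tx ty (Fin.suc-injective eq))
... | false = cong fsuc (rank-injective m (P ∘ fsuc) x y tx ty eq)

numPeriodic≡count : ∀ A → numPeriodic A ≡ count (size A) (isPeriodic A)
numPeriodic≡count A = cong sum (map-tabulate id (λ u → if isPeriodic A u then 1 else 0))

periodicIndex : ∀ A → PeriodicState A → Fin (numPeriodic A)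
periodicIndex A (u , t) = subst Fin (sym (numPeriodic≡count A)) (rank (size A) (isPeriodic A) u t)

periodicIndex-injective : ∀ A {x y} → periodicIndex A x ≡ periodicIndex A y → x ≡ y
periodicIndex-injective A {u , tu} {v , tv} eq
  with refl ← rank-injective (size A) (isPeriodic A) u v tu tv (subst-injective (sym (numPeriodic≡count A)) eq)
  = cong (u ,_) (T-irrelevant tu tv)

record System : Set₁ where
  field
    State : Set
    decEq : DecidableEquality State
    step  : State → State

open System public

system : FDDS → System
system A = record { State = Fin (size A) ; decEq = Fin._≟_ ; step = f A }

_×ˢ_ : System → System → System
S₁ ×ˢ S₂ = record
  { State = State S₁ × State S₂
  ; decEq = ≡-dec (decEq S₁) (decEq S₂)
  ; step  = λ (s₁ , s₂) → step S₁ s₁ , step S₂ s₂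
  }

^-×ˢ : ∀ S₁ S₂ k s₁ s₂ →
       (step (S₁ ×ˢ S₂) ^ k) (s₁ , s₂) ≡ ((step S₁ ^ k) s₁ , (step S₂ ^ k) s₂)
^-×ˢ S₁ S₂ zero    s₁ s₂ = refl
^-×ˢ S₁ S₂ (suc k) s₁ s₂ = cong (step (S₁ ×ˢ S₂)) (^-×ˢ S₁ S₂ k s₁ s₂)

Periodic-×ˢ : ∀ S₁ S₂ {s₁ s₂} → Periodic (step S₁) s₁ → Periodic (step S₂) s₂ →
              Periodic (step (S₁ ×ˢ S₂)) (s₁ , s₂)
Periodic-×ˢ S₁ S₂ {s₁} {s₂} per₁ per₂ =
  let M , fix₁ , fix₂ = commonPeriod (step S₁) (step S₂) per₁ per₂
  in M , trans (^-×ˢ S₁ S₂ (suc M) s₁ s₂) (cong₂ _,_ fix₁ fix₂)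

-- Fibre S u k is the k-th level of the unroll tree of S in u.
Fibre : (S : System) → State S → ℕ → Set
Fibre S u k = Σ (State S) λ s → (step S ^ k) s ≡ u

fibreStep : ∀ S {u} k → Fibre S u (suc k) → Fibre S u k
fibreStep S k (s , e) = step S s , trans (^-step (step S) k s) e

descend : ∀ S {u} j {k m} → j + k ≡ m → Fibre S u m → Fibre S u k
descend S j {k} j+k≡m (s , e) =
  (step S ^ j) s , trans (sym (^-+ (step S) k j s)) (trans (cong (λ i → (step S ^ i) s) (trans (+-comm k j) j+k≡m)) e)

Fibre-≡ : ∀ S {u} k {x y : Fibre S u k} → proj₁ x ≡ proj₁ y → x ≡ y
Fibre-≡ S k {s , e} {.s , e'} refl = cong (s ,_) (uip e e')

record FibreIso (S S' : System) (u : State S) (u' : State S') (Q : ℕ → Set) : Set where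
  field
    φ     : ∀ k → Q k → Fibre S u k → Fibre S' u' k
    ψ     : ∀ k → Q k → Fibre S' u' k → Fibre S u k
    ψ∘φ   : ∀ k q x → ψ k q (φ k q x) ≡ x
    φ∘ψ   : ∀ k q y → φ k q (ψ k q y) ≡ y
    φ-step : ∀ k (q : Q k) (q' : Q (suc k)) x → φ k q (fibreStep S k x) ≡ fibreStep S' k (φ (suc k) q' x)

FibreIso-sym : ∀ {S S' u u' Q} → FibreIso S S' u u' Q → FibreIso S' S u' u Q
FibreIso-sym {S} {S'} I = record
  { φ = ψ ; ψ = φ ; ψ∘φ = φ∘ψ ; φ∘ψ = ψ∘φ
  ; φ-step = λ k q q' y → begin
      ψ k q (fibreStep S' k y)                                   ≡⟨ cong (ψ k q ∘ fibreStep S' k) (φ∘ψ (suc k) q' y) ⟨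
      ψ k q (fibreStep S' k (φ (suc k) q' (ψ (suc k) q' y)))     ≡⟨ cong (ψ k q) (φ-step k q q' (ψ (suc k) q' y)) ⟨
      ψ k q (φ k q (fibreStep S k (ψ (suc k) q' y)))             ≡⟨ ψ∘φ k q _ ⟩
      fibreStep S k (ψ (suc k) q' y)                             ∎ }
  where open FibreIso I
        open ≡-Reasoning

FibreIso-restrict : ∀ {S S' u u'} {Q : ℕ → Set} → FibreIso S S' u u' (λ _ → ⊤) → FibreIso S S' u u' Q
FibreIso-restrict I = record
  { φ = λ k _ → φ k tt ; ψ = λ k _ → ψ k tt ; ψ∘φ = λ k _ → ψ∘φ k tt ; φ∘ψ = λ k _ → φ∘ψ k tt
  ; φ-step = λ k _ _ → φ-step k tt tt }
  where open FibreIso I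

≅ᵗ-sym : ∀ {t t'} → t ≅ᵗ t' → t' ≅ᵗ t
≅ᵗ-sym {t} {t'} i = record
  { bij      = mk↔ₛ′ from to strictlyInverseʳ strictlyInverseˡ
  ; rootPres = trans (cong from (sym rootPres)) (strictlyInverseʳ (root t))
  ; arcPres  = λ x y → mk⇔
      (λ a → Equivalence.from (arcPres (from x) (from y))
               (subst₂ (arc t') (sym (strictlyInverseˡ x)) (sym (strictlyInverseˡ y)) a))
      (λ a → subst₂ (arc t') (strictlyInverseˡ x) (strictlyInverseˡ y)
               (Equivalence.to (arcPres (from x) (from y)) a)) }
  where open _≅ᵗ_ i
        open Inverse bij

≅ᵗ-trans : ∀ {t t' t''} → t ≅ᵗ t' → t' ≅ᵗ t'' → t ≅ᵗ t''
≅ᵗ-trans i j = record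
  { bij      = mk↔ₛ′ (J.to ∘ I.to) (I.from ∘ J.from)
                 (λ z → trans (cong J.to (I.strictlyInverseˡ (J.from z))) (J.strictlyInverseˡ z))
                 (λ x → trans (cong I.from (J.strictlyInverseʳ (I.to x))) (I.strictlyInverseʳ x))
  ; rootPres = trans (cong J.to (_≅ᵗ_.rootPres i)) (_≅ᵗ_.rootPres j)
  ; arcPres  = λ x y → mk⇔
      (Equivalence.to (_≅ᵗ_.arcPres j (I.to x) (I.to y)) ∘ Equivalence.to (_≅ᵗ_.arcPres i x y))
      (Equivalence.from (_≅ᵗ_.arcPres i x y) ∘ Equivalence.from (_≅ᵗ_.arcPres j (I.to x) (I.to y))) }
  where module I = Inverse (_≅ᵗ_.bij i)
        module J = Inverse (_≅ᵗ_.bij j)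

record Node (S : System) (u : State S) (Q : ℕ → Set) : Set where
  constructor node
  field
    level   : ℕ
    inQ     : Q level
    element : Fibre S u level

open Node

levelTree : (S : System) → State S → (Q : ℕ → Set) → Q 0 → RTree
levelTree S u Q q₀ = record
  { V         = Node S u Q
  ; root      = node 0 q₀ (u , refl)
  ; arc       = λ v w → (step S (proj₁ (element v)) ≡ proj₁ (element w)) × (level v ≡ suc (level w))
  ; dep       = level
  ; rootDepth = refl
  }

fibreAt : ∀ {S u Q k} (v : Node S u Q) → level v ≡ k → Fibre S u k
fibreAt (node _ _ x) refl = x

fibreAt-cong : ∀ {S u Q k} {v w : Node S u Q} → v ≡ w → (d : level v ≡ k) (d' : level w ≡ k) → fibreAt v d ≡ fibreAt w d'
fibreAt-cong {v = v} refl d d' = cong (fibreAt v) (uip d d')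

fibreAt-element : ∀ {S u Q k} (v : Node S u Q) (d : level v ≡ k) → proj₁ (fibreAt v d) ≡ proj₁ (element v)
fibreAt-element (node _ _ x) refl = refl

module _ {Q : ℕ → Set} (Q-irrelevant : ∀ {k} (q q' : Q k) → q ≡ q') where

  FibreIso⇒≅ᵗ : ∀ {S S' u u' q₀ q₀'} → FibreIso S S' u u' Q → levelTree S u Q q₀ ≅ᵗ levelTree S' u' Q q₀'
  FibreIso⇒≅ᵗ {S} {S'} {u} {u'} {q₀} {q₀'} I = record
    { bij      = mk↔ₛ′ to from (λ (node k q y) → cong (node k q) (φ∘ψ k q y))
                               (λ (node k q x) → cong (node k q) (ψ∘φ k q x))
    ; rootPres = cong₂ (node 0) (Q-irrelevant q₀ q₀') (Fibre-≡ S' 0 (proj₂ (φ 0 q₀ (u , refl))))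
    ; arcPres  = λ v w → mk⇔ (forward v w) (backward v w) }
    where
      open FibreIso I
      to : Node S u Q → Node S' u' Q
      to (node k q x) = node k q (φ k q x)
      from : Node S' u' Q → Node S u Q
      from (node k q y) = node k q (ψ k q y)
      forward : ∀ v w → arc (levelTree S u Q q₀) v w → arc (levelTree S' u' Q q₀') (to v) (to w)
      forward (node _ q x) (node k q' y) (s≡ , refl) =
        cong proj₁ (trans (sym (φ-step k q' q x)) (cong (φ k q') (Fibre-≡ S k s≡))) , refl
      backward : ∀ v w → arc (levelTree S' u' Q q₀') (to v) (to w) → arc (levelTree S u Q q₀) v w
      backward (node _ q x) (node k q' y) (s≡ , refl) =
        cong proj₁ (begin
          fibreStep S k x                          ≡⟨ ψ∘φ k q' _ ⟨
          ψ k q' (φ k q' (fibreStep S k x))        ≡⟨ cong (ψ k q') (φ-step k q' q x) ⟩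
          ψ k q' (fibreStep S' k (φ (suc k) q x))  ≡⟨ cong (ψ k q') (Fibre-≡ S' k s≡) ⟩
          ψ k q' (φ k q' y)                        ≡⟨ ψ∘φ k q' y ⟩
          y                                        ∎) , refl
        where open ≡-Reasoning

  node-fibreAt : ∀ {S u k} (v : Node S u Q) (d : level v ≡ k) (q : Q k) → node k q (fibreAt v d) ≡ v
  node-fibreAt (node _ q' x) refl q = cong (λ q → node _ q x) (Q-irrelevant q q')

  module _ (Q-down : ∀ {k} → Q (suc k) → Q k) where

    module _ {S S' u u' q₀ q₀'} (i : levelTree S u Q q₀ ≅ᵗ levelTree S' u' Q q₀') where

      open _≅ᵗ_ i
      open Inverse bij

      ≅ᵗ-level : ∀ k q x → level (to (node k q x)) ≡ k
      ≅ᵗ-level zero    q (s , refl) =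
        trans (cong (λ q → level (to (node 0 q (s , refl)))) (Q-irrelevant q q₀)) (cong level rootPres)
      ≅ᵗ-level (suc k) q x =
        trans (proj₂ (Equivalence.to (arcPres (node (suc k) q x) (node k (Q-down q) (fibreStep S k x))) (refl , refl)))
              (cong suc (≅ᵗ-level k (Q-down q) (fibreStep S k x)))

      levelMap : ∀ k → Q k → Fibre S u k → Fibre S' u' k
      levelMap k q x = fibreAt (to (node k q x)) (≅ᵗ-level k q x)

      levelMap-step : ∀ k (q : Q k) (q' : Q (suc k)) x →
                      levelMap k q (fibreStep S k x) ≡ fibreStep S' k (levelMap (suc k) q' x)
      levelMap-step k q q' x = Fibre-≡ S' k (begin
        proj₁ (levelMap k q (fibreStep S k x))      ≡⟨ fibreAt-element (to below) (≅ᵗ-level k q (fibreStep S k x)) ⟩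
        proj₁ (element (to below))                  ≡⟨ proj₁ (Equivalence.to (arcPres above below) (refl , refl)) ⟨
        step S' (proj₁ (element (to above)))        ≡⟨ cong (step S') (fibreAt-element (to above) (≅ᵗ-level (suc k) q' x)) ⟨
        step S' (proj₁ (levelMap (suc k) q' x))     ∎)
        where
          open ≡-Reasoning
          above = node (suc k) q' x
          below = node k q (fibreStep S k x)

    levelMap-inverse : ∀ {S S' u u' q₀ q₀'}
                         (i : levelTree S u Q q₀ ≅ᵗ levelTree S' u' Q q₀')
                         (j : levelTree S' u' Q q₀' ≅ᵗ levelTree S u Q q₀) →
                         (∀ v → Inverse.to (_≅ᵗ_.bij j) (Inverse.to (_≅ᵗ_.bij i) v) ≡ v) →
                         ∀ k q x → levelMap j k q (levelMap i k q x) ≡ x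
    levelMap-inverse i j j∘i k q x =
      fibreAt-cong (trans (cong (Inverse.to (_≅ᵗ_.bij j)) (node-fibreAt _ (≅ᵗ-level i k q x) q)) (j∘i (node k q x)))
                   (≅ᵗ-level j k q (levelMap i k q x)) refl

    ≅ᵗ⇒FibreIso : ∀ {S S' u u' q₀ q₀'} → levelTree S u Q q₀ ≅ᵗ levelTree S' u' Q q₀' → FibreIso S S' u u' Q
    ≅ᵗ⇒FibreIso i = record
      { φ      = levelMap i
      ; ψ      = levelMap (≅ᵗ-sym i)
      ; ψ∘φ    = levelMap-inverse i (≅ᵗ-sym i) (Inverse.strictlyInverseʳ (_≅ᵗ_.bij i))
      ; φ∘ψ    = levelMap-inverse (≅ᵗ-sym i) i (Inverse.strictlyInverseˡ (_≅ᵗ_.bij i))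
      ; φ-step = levelMap-step i }

-- Generalises truncᵗ: truncᵗ n t is definitionally restrictᵗ (_≤ n) z≤n t.
restrictᵗ : (Q : ℕ → Set) → Q 0 → RTree → RTree
restrictᵗ Q q₀ t = record
  { V         = Σ (V t) λ v → Q (dep t v)
  ; root      = root t , subst Q (sym (rootDepth t)) q₀
  ; arc       = λ x y → arc t (proj₁ x) (proj₁ y)
  ; dep       = λ x → dep t (proj₁ x)
  ; rootDepth = rootDepth t
  }

≅ᵗ-restrict⊤ : ∀ t → t ≅ᵗ restrictᵗ (λ _ → ⊤) tt t
≅ᵗ-restrict⊤ t = record
  { bij      = mk↔ₛ′ (_, tt) proj₁ (λ _ → refl) (λ _ → refl)
  ; rootPres = refl
  ; arcPres  = λ _ _ → mk⇔ id id }

⊗ᵗ-restrict⊤ : ∀ t₁ t₂ → (t₁ ⊗ᵗ t₂) ≅ᵗ (restrictᵗ (λ _ → ⊤) tt t₁ ⊗ᵗ restrictᵗ (λ _ → ⊤) tt t₂)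
⊗ᵗ-restrict⊤ t₁ t₂ = record
  { bij      = mk↔ₛ′ (λ ((v₁ , v₂) , d) → ((v₁ , tt) , (v₂ , tt)) , d)
                     (λ (((v₁ , _) , (v₂ , _)) , d) → (v₁ , v₂) , d) (λ _ → refl) (λ _ → refl)
  ; rootPres = refl
  ; arcPres  = λ _ _ → mk⇔ id id }

restrictᵗ-unrollTree : ∀ {Q q₀} A b → restrictᵗ Q q₀ (unrollTree A b) ≅ᵗ levelTree (system A) b Q q₀
restrictᵗ-unrollTree {Q} {q₀} A b = record
  { bij      = mk↔ₛ′ to from (λ (node k q (s , e)) → cong (λ e → node k q (s , e)) (uip _ _))
                             (λ (((s , k) , e) , q) → cong (λ e → ((s , k) , e) , q) (uip _ _))
  ; rootPres = refl
  ; arcPres  = λ _ _ → mk⇔ id id }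
  where
    to : V (restrictᵗ Q q₀ (unrollTree A b)) → Node (system A) b Q
    to (((s , k) , e) , q) = node k q (s , trans (sym (iter≡^ (f A) k s)) e)
    from : Node (system A) b Q → V (restrictᵗ Q q₀ (unrollTree A b))
    from (node k q (s , e)) = ((s , k) , trans (iter≡^ (f A) k s) e) , q

module _ {Q : ℕ → Set} (Q-irrelevant : ∀ {k} (q q' : Q k) → q ≡ q') {q₀ : Q 0} (A X : FDDS)
         {a : Fin (size A)} {x : Fin (size X)} where

  private
    Tᴬ = restrictᵗ Q q₀ (unrollTree A a)
    Tˣ = restrictᵗ Q q₀ (unrollTree X x)
    AX = system A ×ˢ system X

    pairReach : ∀ k s₁ s₂ → iter (f A) k s₁ ≡ a → iter (f X) k s₂ ≡ x → (step AX ^ k) (s₁ , s₂) ≡ (a , x)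
    pairReach k s₁ s₂ e₁ e₂ = trans (^-×ˢ (system A) (system X) k s₁ s₂)
      (cong₂ _,_ (trans (sym (iter≡^ (f A) k s₁)) e₁) (trans (sym (iter≡^ (f X) k s₂)) e₂))

    reach₁ : ∀ k s₁ s₂ → (step AX ^ k) (s₁ , s₂) ≡ (a , x) → iter (f A) k s₁ ≡ a
    reach₁ k s₁ s₂ e = trans (iter≡^ (f A) k s₁) (cong proj₁ (trans (sym (^-×ˢ (system A) (system X) k s₁ s₂)) e))

    reach₂ : ∀ k s₁ s₂ → (step AX ^ k) (s₁ , s₂) ≡ (a , x) → iter (f X) k s₂ ≡ x
    reach₂ k s₁ s₂ e = trans (iter≡^ (f X) k s₂) (cong proj₂ (trans (sym (^-×ˢ (system A) (system X) k s₁ s₂)) e))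

  restrictᵗ-unrollTree-⊗ᵗ : (Tᴬ ⊗ᵗ Tˣ) ≅ᵗ levelTree AX (a , x) Q q₀
  restrictᵗ-unrollTree-⊗ᵗ = record
    { bij      = mk↔ₛ′ to from to∘from from∘to
    ; rootPres = cong (λ e → node 0 q₀ ((a , x) , e)) (uip _ _)
    ; arcPres  = λ v w → mk⇔ (forward v w) (backward v w) }
    where
      to : V (Tᴬ ⊗ᵗ Tˣ) → Node AX (a , x) Q
      to (((((s₁ , k) , e₁) , q) , (((s₂ , _) , e₂) , _)) , refl) = node k q ((s₁ , s₂) , pairReach k s₁ s₂ e₁ e₂)
      from : Node AX (a , x) Q → V (Tᴬ ⊗ᵗ Tˣ)
      from (node k q ((s₁ , s₂) , e)) =
        ((((s₁ , k) , reach₁ k s₁ s₂ e) , q) , (((s₂ , k) , reach₂ k s₁ s₂ e) , q)) , refl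
      to∘from : ∀ v → to (from v) ≡ v
      to∘from (node k q ((s₁ , s₂) , e)) = cong (λ e → node k q ((s₁ , s₂) , e)) (uip _ _)
      from∘to : ∀ v → from (to v) ≡ v
      from∘to (((((s₁ , k) , e₁) , q) , (((s₂ , _) , e₂) , q')) , refl)
        rewrite uip (reach₁ k s₁ s₂ (pairReach k s₁ s₂ e₁ e₂)) e₁
              | uip (reach₂ k s₁ s₂ (pairReach k s₁ s₂ e₁ e₂)) e₂
              | Q-irrelevant q q' = refl
      forward : ∀ v w → arc (Tᴬ ⊗ᵗ Tˣ) v w → arc (levelTree AX (a , x) Q q₀) (to v) (to w)
      forward (_ , refl) (_ , refl) ((p₁ , d) , (p₂ , _)) = cong₂ _,_ p₁ p₂ , d
      backward : ∀ v w → arc (levelTree AX (a , x) Q q₀) (to v) (to w) → arc (Tᴬ ⊗ᵗ Tˣ) v w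
      backward (_ , refl) (_ , refl) (p , d) = (cong proj₁ p , d) , (cong proj₂ p , d)

module _ (S : System) where

  private
    g = step S

  -- In the unroll tree of a, the nodes i + 1 levels above the root that do not descend from the child a'.
  record InBranch (a a' : State S) (i : ℕ) (s : State S) : Set where
    constructor mkInBranch
    field
      reaches : (g ^ suc i) s ≡ a
      avoids  : False (decEq S ((g ^ i) s) a')

  Branch : State S → State S → ℕ → Set
  Branch a a' i = Σ (State S) (InBranch a a' i)

  Branch-≡ : ∀ {a a' i} {x y : Branch a a' i} → proj₁ x ≡ proj₁ y → x ≡ y
  Branch-≡ {x = s , mkInBranch e ne} {.s , mkInBranch e' ne'} refl =
    cong₂ (λ e ne → s , mkInBranch e ne) (uip e e') (T-irrelevant ne ne')

  inBranchStep : ∀ {a a' i s} → InBranch a a' (suc i) s → InBranch a a' i (g s)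
  inBranchStep {a' = a'} {i} {s} (mkInBranch e ne) =
    mkInBranch (trans (^-step g (suc i) s) e) (subst (λ z → False (decEq S z a')) (sym (^-step g i s)) ne)

  inBranchUnstep : ∀ {a a' i s} → InBranch a a' i (g s) → InBranch a a' (suc i) s
  inBranchUnstep {a' = a'} {i} {s} (mkInBranch e ne) =
    mkInBranch (trans (sym (^-step g (suc i) s)) e) (subst (λ z → False (decEq S z a')) (^-step g i s) ne)

  inBranch-^ : ∀ {a a' i} m {s} → InBranch a a' (i + m) s → InBranch a a' i ((g ^ m) s)
  inBranch-^ {a' = a'} {i} m {s} (mkInBranch e ne) =
    mkInBranch (trans (sym (^-+ g (suc i) m s)) e) (subst (λ z → False (decEq S z a')) (^-+ g i m s) ne)

  branchStep : ∀ {a a' i} → Branch a a' (suc i) → Branch a a' i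
  branchStep (s , o) = g s , inBranchStep o

  lowerBranch : ∀ {a a' i} h → h ≤ i → Branch a a' i → Branch a a' h
  lowerBranch h h≤i (s , o) with m , refl ← m≤n⇒∃[o]m+o≡n h≤i = (g ^ m) s , inBranch-^ m o

record BranchIso (S S' : System) (a a' : State S) (b b' : State S') : Set where
  field
    χ      : ∀ i → Branch S a a' i → Branch S' b b' i
    ω      : ∀ i → Branch S' b b' i → Branch S a a' i
    ω∘χ    : ∀ i x → ω i (χ i x) ≡ x
    χ∘ω    : ∀ i y → χ i (ω i y) ≡ y
    χ-step : ∀ i x → χ i (branchStep S x) ≡ branchStep S' (χ (suc i) x)

open BranchIso public

BranchIso-refl : ∀ {S a a'} → BranchIso S S a a' a a'
BranchIso-refl = record
  { χ = λ _ x → x ; ω = λ _ x → x ; ω∘χ = λ _ _ → refl ; χ∘ω = λ _ _ → refl ; χ-step = λ _ _ → refl }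

BranchIso-sym : ∀ {S S' a a' b b'} → BranchIso S S' a a' b b' → BranchIso S' S b b' a a'
BranchIso-sym {S} {S'} F = record
  { χ = ω F ; ω = χ F ; ω∘χ = χ∘ω F ; χ∘ω = ω∘χ F
  ; χ-step = λ i y → begin
      ω F i (branchStep S' y)                                       ≡⟨ cong (ω F i ∘′ branchStep S') (χ∘ω F (suc i) y) ⟨
      ω F i (branchStep S' (χ F (suc i) (ω F (suc i) y)))           ≡⟨ cong (ω F i) (χ-step F i (ω F (suc i) y)) ⟨
      ω F i (χ F i (branchStep S (ω F (suc i) y)))                  ≡⟨ ω∘χ F i _ ⟩
      branchStep S (ω F (suc i) y)                                  ∎ }
  where open ≡-Reasoning

BranchIso-trans : ∀ {S S' S'' a a' b b' c c'} → BranchIso S S' a a' b b' → BranchIso S' S'' b b' c c' → BranchIso S S'' a a' c c'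
BranchIso-trans F G = record
  { χ      = λ i x → χ G i (χ F i x)
  ; ω      = λ i y → ω F i (ω G i y)
  ; ω∘χ    = λ i x → trans (cong (ω F i) (ω∘χ G i (χ F i x))) (ω∘χ F i x)
  ; χ∘ω    = λ i y → trans (cong (χ G i) (χ∘ω F i (ω G i y))) (χ∘ω G i y)
  ; χ-step = λ i x → trans (cong (χ G i) (χ-step F i x)) (χ-step G i (χ F (suc i) x)) }

-- The spine of the unroll tree of a periodic state u: spine k is the periodic node on level k.
module Spine (S : System) {u : State S} (per : Periodic (step S) u) where

  private
    g = step S
    p = proj₁ per

  spine : ℕ → State S
  spine k = (g ^ (k * p)) u

  spine-step : ∀ k → g (spine (suc k)) ≡ spine k
  spine-step k = trans (^-+ g (suc p) (k * p) u) (trans (^-comm g (suc p) (k * p) u) (cong (g ^ (k * p)) (proj₂ per)))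

  ^-spine : ∀ i m → (g ^ i) (spine (i + m)) ≡ spine m
  ^-spine zero    m = refl
  ^-spine (suc i) m = trans (sym (^-step g i (spine (suc (i + m))))) (trans (cong (g ^ i) (spine-step (i + m))) (^-spine i m))

  spine-reaches : ∀ k → (g ^ k) (spine k) ≡ u
  spine-reaches k = trans (cong (λ m → (g ^ k) (spine m)) (sym (+-identityʳ k))) (^-spine k 0)

  spine-periodic : ∀ m → spine (suc p + m) ≡ spine m
  spine-periodic m = trans (sym (spine-fixed (suc p + m))) (^-spine (suc p) m)
    where
      spine-fixed : ∀ k → (g ^ suc p) (spine k) ≡ spine k
      spine-fixed k = trans (^-comm g (suc p) (k * p) u) (cong (g ^ (k * p)) (proj₂ per))

  inBranch-reaches : ∀ {j i s} → InBranch S (spine j) (spine (suc j)) i s → (g ^ (suc i + j)) s ≡ u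
  inBranch-reaches {j} {i} {s} o = begin
    (g ^ (suc i + j)) s          ≡⟨ cong (λ m → (g ^ m) s) (+-comm (suc i) j) ⟩
    (g ^ (j + suc i)) s          ≡⟨ ^-+ g j (suc i) s ⟩
    (g ^ j) ((g ^ suc i) s)      ≡⟨ cong (g ^ j) (InBranch.reaches o) ⟩
    (g ^ j) (spine j)            ≡⟨ spine-reaches j ⟩
    u                            ∎
    where open ≡-Reasoning

  -- Every node on level k of the unroll tree lies on the spine or in exactly one branch.
  data Position (k : ℕ) (s : State S) : Set where
    onSpine  : s ≡ spine k → Position k s
    inBranch : ∀ j i → suc i + j ≡ k → InBranch S (spine j) (spine (suc j)) i s → Position k s

  Position-reaches : ∀ {k s} → Position k s → (g ^ k) s ≡ u
  Position-reaches {k} (onSpine refl)      = spine-reaches k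
  Position-reaches (inBranch j i refl o)   = inBranch-reaches o

  position : ∀ k s → (g ^ k) s ≡ u → Position k s
  position zero    s e = onSpine e
  position (suc k) s e with decEq S s (spine (suc k))
  ... | yes s≡ = onSpine s≡
  ... | no  s≢ with position k (g s) (trans (^-step g k s) e)
  ...   | onSpine gs≡          = inBranch k 0 refl (mkInBranch gs≡ (fromWitnessFalse s≢))
  ...   | inBranch j i refl o  = inBranch j (suc i) refl (inBranchUnstep S o)

  private
    spine-notInBranch : ∀ {s j i} → s ≡ spine (suc i + j) → InBranch S (spine j) (spine (suc j)) i s → ⊥
    spine-notInBranch {j = j} {i} refl o =
      toWitnessFalse (InBranch.avoids o) (trans (cong (λ m → (g ^ i) (spine m)) (sym (+-suc i j))) (^-spine i (suc j)))

    branches-disjoint : ∀ {s j i j' i'} → j < j' → suc i + j ≡ suc i' + j' →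
                        InBranch S (spine j) (spine (suc j)) i s → InBranch S (spine j') (spine (suc j')) i' s → ⊥
    branches-disjoint {s} {j} {i} {j'} {i'} j<j' same-level o o' = toWitnessFalse (InBranch.avoids o) (begin
      (g ^ i) s                        ≡⟨ cong (λ m → (g ^ m) s) i≡d+1+i' ⟩
      (g ^ (d + suc i')) s             ≡⟨ ^-+ g d (suc i') s ⟩
      (g ^ d) ((g ^ suc i') s)         ≡⟨ cong (g ^ d) (InBranch.reaches o') ⟩
      (g ^ d) (spine j')               ≡⟨ cong (λ m → (g ^ d) (spine m)) (trans (sym j+d≡j') (+-comm (suc j) d)) ⟩
      (g ^ d) (spine (d + suc j))      ≡⟨ ^-spine d (suc j) ⟩
      spine (suc j)                    ∎)
      where
        open ≡-Reasoning
        d   = proj₁ (m≤n⇒∃[o]m+o≡n j<j')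
        j+d≡j' : suc j + d ≡ j'
        j+d≡j' = proj₂ (m≤n⇒∃[o]m+o≡n j<j')
        shuffle : ∀ i' j d → suc i' + (suc j + d) ≡ (d + suc i') + suc j
        shuffle = solve-∀
        i≡d+1+i' : i ≡ d + suc i'
        i≡d+1+i' = +-cancelʳ-≡ (suc j) i (d + suc i')
          (trans (+-suc i j) (trans same-level (trans (cong (suc i' +_) (sym j+d≡j')) (shuffle i' j d))))

    branch-unique : ∀ {s j i j' i'} → suc i + j ≡ suc i' + j' →
                    InBranch S (spine j) (spine (suc j)) i s → InBranch S (spine j') (spine (suc j')) i' s →
                    j ≡ j' × i ≡ i'
    branch-unique {j = j} {i} {j'} {i'} same-level o o' with <-cmp j j'
    ... | tri< j<j' _ _ = ⊥-elim (branches-disjoint j<j' same-level o o')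
    ... | tri> _ _ j'<j = ⊥-elim (branches-disjoint j'<j (sym same-level) o' o)
    ... | tri≈ _ refl _ = refl , suc-injective (+-cancelʳ-≡ j (suc i) (suc i') same-level)

  Position-irrelevant : ∀ {k s} (v w : Position k s) → v ≡ w
  Position-irrelevant (onSpine e)          (onSpine e')        = cong onSpine (uip e e')
  Position-irrelevant (onSpine e)          (inBranch j i q o)  = ⊥-elim (spine-notInBranch (trans e (cong spine (sym q))) o)
  Position-irrelevant (inBranch j i q o)   (onSpine e)         = ⊥-elim (spine-notInBranch (trans e (cong spine (sym q))) o)
  Position-irrelevant (inBranch j i q o)   (inBranch j' i' q' o')
    with refl , refl ← branch-unique (trans q (sym q')) o o' =
    cong₂ (inBranch j i) (uip q q') (cong₂ mkInBranch (uip _ _) (T-irrelevant _ _))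

module FineWilf {Obj : Set₁} (_∼_ : Obj → Obj → Set)
                (∼-refl : ∀ {x} → x ∼ x) (∼-sym : ∀ {x y} → x ∼ y → y ∼ x)
                (∼-trans : ∀ {x y z} → x ∼ y → y ∼ z → x ∼ z)
                {p q D n : ℕ} (U W : ℕ → Obj)
                (U-periodic : ∀ j → U (suc p + j) ≡ U j) (W-periodic : ∀ j → W (suc q + j) ≡ W j)
                (agree : ∀ j → suc j + D ≤ n → U j ∼ W j) (bound : suc p + suc q + D ≤ n) where

  private
    P = suc p
    Q = suc q

    ≡⇒∼ : ∀ {x y} → x ≡ y → x ∼ y
    ≡⇒∼ refl = ∼-refl

    agree-below : ∀ j → suc j ≤ P + Q → U j ∼ W j
    agree-below j j<P+Q = agree j (≤-trans (+-monoˡ-≤ D j<P+Q) bound)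

    W-shift : ∀ i → W (P + i) ∼ W i
    W-shift = <-rec _ shift
      where
        shift : ∀ i → (∀ {i'} → i' < i → W (P + i') ∼ W i') → W (P + i) ∼ W i
        shift i rec with i <? Q
        ... | yes i<Q =
          ∼-trans (∼-sym (agree-below (P + i) (≤-trans (≤-reflexive (sym (+-suc P i))) (+-monoʳ-≤ P i<Q))))
            (∼-trans (≡⇒∼ (U-periodic i)) (agree-below i (≤-trans i<Q (m≤n+m Q P))))
        ... | no i≮Q with i' , refl ← m≤n⇒∃[o]m+o≡n (≮⇒≥ i≮Q) =
          ∼-trans (≡⇒∼ (cong W (trans (sym (+-assoc P Q i')) (trans (cong (_+ i') (+-comm P Q)) (+-assoc Q P i')))))
            (∼-trans (≡⇒∼ (W-periodic (P + i')))
              (∼-trans (rec (s≤s (m≤n+m i' q))) (≡⇒∼ (sym (W-periodic i')))))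

  fineWilf : ∀ j → U j ∼ W j
  fineWilf = <-rec _ agreeAt
    where
      agreeAt : ∀ j → (∀ {j'} → j' < j → U j' ∼ W j') → U j ∼ W j
      agreeAt j rec with j <? P
      ... | yes j<P = agree-below j (≤-trans j<P (m≤m+n P Q))
      ... | no j≮P with j' , refl ← m≤n⇒∃[o]m+o≡n (≮⇒≥ j≮P) =
        ∼-trans (≡⇒∼ (U-periodic j')) (∼-trans (rec (s≤s (m≤n+m j' p))) (∼-sym (W-shift j')))

SpineBranchIso : (S S' : System) {u : State S} {u' : State S'} → Periodic (step S) u → Periodic (step S') u' → ℕ → Set
SpineBranchIso S S' per per' j =
  BranchIso S S' (Spine.spine S per j) (Spine.spine S per (suc j)) (Spine.spine S' per' j) (Spine.spine S' per' (suc j))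

module Transport (S S' : System) {u u'} (per : Periodic (step S) u) (per' : Periodic (step S') u')
                 (fam : ∀ j → SpineBranchIso S S' per per' j) where

  open Spine S per
  open Spine S' per' using () renaming
    (spine to spine'; spine-step to spine'-step; Position to Position'; onSpine to onSpine'; inBranch to inBranch')

  transport : ∀ {k s} → Position k s → State S'
  transport {k} (onSpine _)                = spine' k
  transport {s = s} (inBranch j i _ o)     = proj₁ (χ (fam j) i (s , o))

  transport-position : ∀ {k s} (v : Position k s) → Position' k (transport v)
  transport-position (onSpine _)           = onSpine' refl
  transport-position {s = s} (inBranch j i q o) = inBranch' j i q (proj₂ (χ (fam j) i (s , o)))

  transport-step : ∀ {k s} (v : Position k (step S s)) (w : Position (suc k) s) → transport v ≡ step S' (transport w)
  transport-step {k} v (onSpine refl) =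
    trans (cong transport (Position-irrelevant v (onSpine (spine-step k)))) (sym (spine'-step k))
  transport-step {s = s} v (inBranch j zero refl o) =
    trans (cong transport (Position-irrelevant v (onSpine (InBranch.reaches o))))
          (sym (InBranch.reaches (proj₂ (χ (fam j) 0 (s , o)))))
  transport-step {s = s} v (inBranch j (suc i) refl o) =
    trans (cong transport (Position-irrelevant v (inBranch j i refl (inBranchStep S o))))
          (cong proj₁ (χ-step (fam j) i (s , o)))

module TransportInverse (S S' : System) {u u'} (per : Periodic (step S) u) (per' : Periodic (step S') u')
                        (fam : ∀ j → SpineBranchIso S S' per per' j) (fam' : ∀ j → SpineBranchIso S' S per' per j)
                        (inverse : ∀ j i x → χ (fam' j) i (χ (fam j) i x) ≡ x) where

  open Spine S per
  open Transport S S' per per' fam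
  open Transport S' S per' per fam' using () renaming (transport to transport')

  transport'∘transport-position : ∀ {k s} (v : Position k s) → transport' (transport-position v) ≡ s
  transport'∘transport-position (onSpine e)                = sym e
  transport'∘transport-position {s = s} (inBranch j i _ o) = cong proj₁ (inverse j i (s , o))

  transport-inverse : ∀ {k s} (v : Position k s) (w : Spine.Position S' per' k (transport v)) → transport' w ≡ s
  transport-inverse v w =
    trans (cong transport' (Spine.Position-irrelevant S' per' w (transport-position v))) (transport'∘transport-position v)

assemble : ∀ {S S' u u'} (per : Periodic (step S) u) (per' : Periodic (step S') u') →
           (∀ j → SpineBranchIso S S' per per' j) →
           FibreIso S S' u u' (λ _ → ⊤)
assemble {S} {S'} {u} {u'} per per' fam = record
  { φ      = λ k _ → forth k
  ; ψ      = λ k _ → back k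
  ; ψ∘φ    = λ k _ (s , e) → Fibre-≡ S k (I.transport-inverse (P.position k s e) (P'.position k _ (proj₂ (forth k (s , e)))))
  ; φ∘ψ    = λ k _ (s , e) → Fibre-≡ S' k (I'.transport-inverse (P'.position k s e) (P.position k _ (proj₂ (back k (s , e)))))
  ; φ-step = λ k _ _ (s , e) → Fibre-≡ S' k
               (T.transport-step (P.position k (step S s) (trans (^-step (step S) k s) e)) (P.position (suc k) s e)) }
  where
    module P  = Spine S per
    module P' = Spine S' per'
    fam' = λ j → BranchIso-sym (fam j)
    module T  = Transport S S' per per' fam
    module T' = Transport S' S per' per fam'
    module I  = TransportInverse S S' per per' fam fam' (λ j → ω∘χ (fam j))
    module I' = TransportInverse S' S per' per fam' fam (λ j → χ∘ω (fam j))
    forth : ∀ k → Fibre S u k → Fibre S' u' k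
    forth k (s , e) = T.transport v , P'.Position-reaches (T.transport-position v)
      where v = P.position k s e
    back : ∀ k → Fibre S' u' k → Fibre S u k
    back k (s , e) = T'.transport v , P.Position-reaches (T'.transport-position v)
      where v = P'.position k s e

module _ {S S' : System} {u u'} {n : ℕ} (I : FibreIso S S' u u' (_≤ n)) where

  open FibreIso I

  φ-irrelevant : ∀ k le le' (x x' : Fibre S u k) → proj₁ x ≡ proj₁ x' → φ k le x ≡ φ k le' x'
  φ-irrelevant k le le' x x' eq = cong₂ (φ k) (≤-irrelevant le le') (Fibre-≡ S k eq)

  φ-injective : ∀ k le (x x' : Fibre S u k) → proj₁ (φ k le x) ≡ proj₁ (φ k le x') → proj₁ x ≡ proj₁ x'
  φ-injective k le x x' eq = cong proj₁ (trans (sym (ψ∘φ k le x)) (trans (cong (ψ k le) (Fibre-≡ S' k eq)) (ψ∘φ k le x')))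

  φ-descend : ∀ j {k m} (j+k≡m : j + k ≡ m) (le : m ≤ n) (le' : k ≤ n) x →
              proj₁ (φ k le' (descend S j j+k≡m x)) ≡ (step S' ^ j) (proj₁ (φ m le x))
  φ-descend zero    refl le le' x = cong proj₁ (φ-irrelevant _ le' le _ x refl)
  φ-descend (suc j) {k} refl le le' x@(s , _) = begin
    proj₁ (φ k le' (descend S (suc j) refl x))
      ≡⟨ cong proj₁ (φ-irrelevant k le' le' _ _ (sym (^-step (step S) j s))) ⟩
    proj₁ (φ k le' (descend S j refl (fibreStep S (j + k) x)))
      ≡⟨ φ-descend j refl le₁ le' _ ⟩
    (step S' ^ j) (proj₁ (φ (j + k) le₁ (fibreStep S (j + k) x)))
      ≡⟨ cong (λ y → (step S' ^ j) (proj₁ y)) (φ-step (j + k) le₁ le x) ⟩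
    (step S' ^ j) (step S' (proj₁ (φ (suc j + k) le x)))
      ≡⟨ ^-step (step S') j _ ⟩
    (step S' ^ suc j) (proj₁ (φ (suc j + k) le x))
      ∎
    where
      open ≡-Reasoning
      le₁ = ≤-trans (n≤1+n _) le

module _ {S S' : System} {u u'} (per : Periodic (step S) u) (per' : Periodic (step S') u') {n : ℕ}
         (I : FibreIso S S' u u' (_≤ n)) where

  open FibreIso I
  open Spine S per
  open Spine S' per' using () renaming (spine to spine'; spine-reaches to spine'-reaches)

  module _ (j : ℕ) (φ-spine   : ∀ le → proj₁ (φ j le (spine j , spine-reaches j)) ≡ spine' j)
                   (φ-spine+1 : ∀ le → proj₁ (φ (suc j) le (spine (suc j) , spine-reaches (suc j))) ≡ spine' (suc j)) where

    branchMap : ∀ i → suc i + j ≤ n → Branch S (spine j) (spine (suc j)) i → Branch S' (spine' j) (spine' (suc j)) i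
    branchMap i le (s , o) = proj₁ (φ (suc i + j) le x) , mkInBranch reaches' avoids'
      where
        x = s , inBranch-reaches o
        le-j : j ≤ n
        le-j = ≤-trans (m≤n+m j (suc i)) le
        le-sj : suc j ≤ n
        le-sj = ≤-trans (≤-trans (m≤n+m (suc j) i) (≤-reflexive (+-suc i j))) le
        reaches' = trans (sym (φ-descend I (suc i) refl le le-j x))
                         (trans (cong proj₁ (φ-irrelevant I j le-j le-j _ _ (InBranch.reaches o))) (φ-spine le-j))
        avoids' = fromWitnessFalse λ hit → toWitnessFalse (InBranch.avoids o)
          (φ-injective I (suc j) le-sj (descend S i (+-suc i j) x) (spine (suc j) , spine-reaches (suc j))
            (trans (φ-descend I i (+-suc i j) le le-sj x) (trans hit (sym (φ-spine+1 le-sj)))))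

    branchMap-step : ∀ i le le' x → proj₁ (branchMap i le (branchStep S x)) ≡ step S' (proj₁ (branchMap (suc i) le' x))
    branchMap-step i le le' (s , o) =
      cong proj₁ (trans (φ-irrelevant I (suc i + j) le le _ _ refl) (φ-step (suc i + j) le le' (s , inBranch-reaches o)))


BranchTriple : Set₁
BranchTriple = Σ System λ S → State S × State S

_≅ᵇ_ : BranchTriple → BranchTriple → Set
(S , a , a') ≅ᵇ (S' , b , b') = BranchIso S S' a a' b b'

-- Once every state of S' is periodic after D steps, its branches have height < D, and an isomorphism of
-- the levels ≤ n identifies the first P + P' branch pairs; Fine and Wilf then propagates this to all of them.
module Extension {S S' : System} {u u'} (per : Periodic (step S) u) (per' : Periodic (step S') u')
                 {D n : ℕ} (settled : ∀ s → Periodic (step S') ((step S' ^ D) s))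
                 (bound : suc (proj₁ per) + suc (proj₁ per') + D ≤ n)
                 (I : FibreIso S S' u u' (_≤ n)) where

  open FibreIso I
  open Spine S per
  open Spine S' per' using () renaming
    (spine to spine'; spine-reaches to spine'-reaches; spine-periodic to spine'-periodic)

  private
    g  = step S
    g' = step S'

  spine'-characterisation : ∀ k s → (g' ^ k) ((g' ^ D) s) ≡ u' → (g' ^ D) s ≡ spine' k
  spine'-characterisation k s e =
    Periodic-injective g' k (settled s) (Periodic-^ g' per' (k * proj₁ per')) (trans e (sym (spine'-reaches k)))

  φ-spine : ∀ k → k + D ≤ n → ∀ le → proj₁ (φ k le (spine k , spine-reaches k)) ≡ spine' k
  φ-spine k k+D≤n le = begin
    proj₁ (φ k le (spine k , spine-reaches k))
      ≡⟨ cong proj₁ (φ-irrelevant I k le le _ (descend S D refl x) (sym (^-spine D k))) ⟩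
    proj₁ (φ k le (descend S D refl x))
      ≡⟨ φ-descend I D refl le' le x ⟩
    (g' ^ D) (proj₁ (φ (D + k) le' x))
      ≡⟨ spine'-characterisation k _ (proj₂ (descend S' D refl (φ (D + k) le' x))) ⟩
    spine' k
      ∎
    where
      open ≡-Reasoning
      le' = subst (_≤ n) (+-comm k D) k+D≤n
      x   = spine (D + k) , spine-reaches (D + k)

  ψ-spine : ∀ k → k + D ≤ n → ∀ le → proj₁ (ψ k le (spine' k , spine'-reaches k)) ≡ spine k
  ψ-spine k k+D≤n le = cong proj₁ (trans (cong (ψ k le) (Fibre-≡ S' k (sym (φ-spine k k+D≤n le)))) (ψ∘φ k le _))

  no-branch'-at-D : ∀ j → Branch S' (spine' j) (spine' (suc j)) D → ⊥
  no-branch'-at-D j (t , o) = toWitnessFalse (InBranch.avoids o) (spine'-characterisation (suc j) t (begin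
    (g' ^ suc j) ((g' ^ D) t)        ≡⟨ ^-step g' j _ ⟨
    (g' ^ j) ((g' ^ suc D) t)        ≡⟨ cong (g' ^ j) (InBranch.reaches o) ⟩
    (g' ^ j) (spine' j)              ≡⟨ spine'-reaches j ⟩
    u'                               ∎))
    where open ≡-Reasoning

  branch'-short : ∀ j {i} → Branch S' (spine' j) (spine' (suc j)) i → i < D
  branch'-short j {i} x with i <? D
  ... | yes i<D = i<D
  ... | no  i≮D = ⊥-elim (no-branch'-at-D j (lowerBranch S' D (≮⇒≥ i≮D) x))

  module _ (j : ℕ) (j+1+D≤n : suc j + D ≤ n) where

    private
      j+D≤n = ≤-trans (n≤1+n _) j+1+D≤n
      map  = branchMap per per' I j (φ-spine j j+D≤n) (φ-spine (suc j) j+1+D≤n)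
      map' = branchMap per' per (FibreIso-sym I) j (ψ-spine j j+D≤n) (ψ-spine (suc j) j+1+D≤n)

      low : ∀ {i} → i < D → suc i + j ≤ n
      low {i} i<D = ≤-trans (+-monoˡ-≤ j i<D) (≤-trans (≤-reflexive (+-comm D j)) j+D≤n)

    branch-short : ∀ {i} → Branch S (spine j) (spine (suc j)) i → i < D
    branch-short {i} x with i <? D
    ... | yes i<D = i<D
    ... | no  i≮D = ⊥-elim (no-branch'-at-D j (map D (≤-trans (≤-reflexive (cong suc (+-comm D j))) j+1+D≤n)
                                                  (lowerBranch S D (≮⇒≥ i≮D) x)))

    -- χ and ω take the decision of i < D as an argument so that the proofs below can case on it.
    private
      χ₀ : ∀ i → Dec (i < D) → Branch S (spine j) (spine (suc j)) i → Branch S' (spine' j) (spine' (suc j)) i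
      χ₀ i (yes i<D)   = map i (low i<D)
      χ₀ i (no i≮D) x  = ⊥-elim (i≮D (branch-short x))

      ω₀ : ∀ i → Dec (i < D) → Branch S' (spine' j) (spine' (suc j)) i → Branch S (spine j) (spine (suc j)) i
      ω₀ i (yes i<D)   = map' i (low i<D)
      ω₀ i (no i≮D) y  = ⊥-elim (i≮D (branch'-short j y))

      ω₀∘χ₀ : ∀ i d d' x → ω₀ i d' (χ₀ i d x) ≡ x
      ω₀∘χ₀ i (yes i<D) (yes i<D') x = Branch-≡ S
        (cong proj₁ (trans (φ-irrelevant (FibreIso-sym I) _ (low i<D') (low i<D) _ _ refl) (ψ∘φ _ (low i<D) _)))
      ω₀∘χ₀ i (yes i<D) (no i≮D) x = ⊥-elim (i≮D i<D)
      ω₀∘χ₀ i (no i≮D)  d'       x = ⊥-elim (i≮D (branch-short x))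

      χ₀∘ω₀ : ∀ i d d' y → χ₀ i d' (ω₀ i d y) ≡ y
      χ₀∘ω₀ i (yes i<D) (yes i<D') y = Branch-≡ S'
        (cong proj₁ (trans (φ-irrelevant I _ (low i<D') (low i<D) _ _ refl) (φ∘ψ _ (low i<D) _)))
      χ₀∘ω₀ i (yes i<D) (no i≮D) y = ⊥-elim (i≮D i<D)
      χ₀∘ω₀ i (no i≮D)  d'       y = ⊥-elim (i≮D (branch'-short j y))

      χ₀-step : ∀ i d d' x → χ₀ i d (branchStep S x) ≡ branchStep S' (χ₀ (suc i) d' x)
      χ₀-step i (yes i<D) (yes i+1<D) x =
        Branch-≡ S' (branchMap-step per per' I j (φ-spine j j+D≤n) (φ-spine (suc j) j+1+D≤n) i (low i<D) (low i+1<D) x)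
      χ₀-step i d        (no i+1≮D) x = ⊥-elim (i+1≮D (branch-short x))
      χ₀-step i (no i≮D) (yes i+1<D) x = ⊥-elim (i≮D (≤-trans (n≤1+n _) i+1<D))

    branchIso : SpineBranchIso S S' per per' j
    branchIso = record
      { χ      = λ i → χ₀ i (i <? D)
      ; ω      = λ i → ω₀ i (i <? D)
      ; ω∘χ    = λ i → ω₀∘χ₀ i (i <? D) (i <? D)
      ; χ∘ω    = λ i → χ₀∘ω₀ i (i <? D) (i <? D)
      ; χ-step = λ i → χ₀-step i (i <? D) (suc i <? D) }

  extend : FibreIso S S' u u' (λ _ → ⊤)
  extend = assemble per per' (FineWilf.fineWilf _≅ᵇ_ BranchIso-refl BranchIso-sym BranchIso-trans U W
                                (periodic {r = proj₁ per} spine spine-periodic)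
                                (periodic {r = proj₁ per'} spine' spine'-periodic)
                                branchIso bound)
    where
      U W : ℕ → BranchTriple
      U j = S  , spine j  , spine (suc j)
      W j = S' , spine' j , spine' (suc j)
      periodic : ∀ {T : System} {r} (π : ℕ → State T) → (∀ m → π (suc r + m) ≡ π m) →
                 ∀ j → _≡_ {A = BranchTriple} (T , π (suc r + j) , π (suc (suc r + j))) (T , π j , π (suc j))
      periodic {T} {r} π π-periodic j =
        cong₂ (λ a a' → T , a , a') (π-periodic j) (trans (cong π (sym (+-suc (suc r) j))) (π-periodic (suc j)))

≅ᵗ-via : ∀ {t₁ t₂ s₁ s₂} → t₁ ≅ᵗ s₁ → t₂ ≅ᵗ s₂ → s₁ ≅ᵗ s₂ → t₁ ≅ᵗ t₂
≅ᵗ-via i₁ i₂ j = ≅ᵗ-trans i₁ (≅ᵗ-trans j (≅ᵗ-sym i₂))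

module _ (A X B : FDDS) (n : ℕ) {a : Fin (size A)} {x : Fin (size X)} {b : Fin (size B)} where

  private
    AX = system A ×ˢ system X

    ⊤-irrelevant : (p q : ⊤) → p ≡ q
    ⊤-irrelevant _ _ = refl

    ≤n-irrelevant : ∀ {k} (p q : k ≤ n) → p ≡ q
    ≤n-irrelevant = ≤-irrelevant

    ≤-down : ∀ {k} → suc k ≤ n → k ≤ n
    ≤-down = ≤-trans (n≤1+n _)

    product⊤ : (unrollTree A a ⊗ᵗ unrollTree X x) ≅ᵗ levelTree AX (a , x) (λ _ → ⊤) tt
    product⊤ = ≅ᵗ-trans (⊗ᵗ-restrict⊤ _ _) (restrictᵗ-unrollTree-⊗ᵗ ⊤-irrelevant A X)

    product≤ : (truncᵗ n (unrollTree A a) ⊗ᵗ truncᵗ n (unrollTree X x)) ≅ᵗ levelTree AX (a , x) (_≤ n) z≤n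
    product≤ = restrictᵗ-unrollTree-⊗ᵗ ≤n-irrelevant A X

    single⊤ : unrollTree B b ≅ᵗ levelTree (system B) b (λ _ → ⊤) tt
    single⊤ = ≅ᵗ-trans (≅ᵗ-restrict⊤ _) (restrictᵗ-unrollTree B b)

    single≤ : truncᵗ n (unrollTree B b) ≅ᵗ levelTree (system B) b (_≤ n) z≤n
    single≤ = restrictᵗ-unrollTree B b

  truncate-≅ᵗ : (unrollTree A a ⊗ᵗ unrollTree X x) ≅ᵗ unrollTree B b →
                (truncᵗ n (unrollTree A a) ⊗ᵗ truncᵗ n (unrollTree X x)) ≅ᵗ truncᵗ n (unrollTree B b)
  truncate-≅ᵗ i = ≅ᵗ-via product≤ single≤ (FibreIso⇒≅ᵗ ≤n-irrelevant (FibreIso-restrict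
    (≅ᵗ⇒FibreIso ⊤-irrelevant (λ _ → tt) (≅ᵗ-via (≅ᵗ-sym product⊤) (≅ᵗ-sym single⊤) i))))

  extend-≅ᵗ : (perAX : Periodic (step AX) (a , x)) (perB : Periodic (f B) b) →
              suc (proj₁ perAX) + suc (proj₁ perB) + depth B ≤ n →
              (truncᵗ n (unrollTree A a) ⊗ᵗ truncᵗ n (unrollTree X x)) ≅ᵗ truncᵗ n (unrollTree B b) →
              (unrollTree A a ⊗ᵗ unrollTree X x) ≅ᵗ unrollTree B b
  extend-≅ᵗ perAX perB bound i = ≅ᵗ-via product⊤ single⊤ (FibreIso⇒≅ᵗ ⊤-irrelevant
    (Extension.extend perAX perB (Periodic-after-depth B) bound
      (≅ᵗ⇒FibreIso ≤n-irrelevant ≤-down (≅ᵗ-via (≅ᵗ-sym product≤) (≅ᵗ-sym single≤) i))))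

statePeriod≤ : ∀ B (b : PeriodicState B) → Σ[ per ∈ Periodic (f B) (proj₁ b) ] suc (proj₁ per) ≤ numPeriodic B
statePeriod≤ B (b , tb) = period≤ (f B) (isPeriodic⇒Periodic B tb) (λ k → periodicIndex B ((f B ^ k) b , isPeriodic-^ B tb k))
                                  (λ _ _ same → cong proj₁ (periodicIndex-injective B same))

pairPeriod≤ : ∀ A X B (σ : (PeriodicState A × PeriodicState X) ↔ PeriodicState B) (i : PeriodicState A × PeriodicState X) →
              let ((a , _) , (x , _)) = i in
              Σ[ per ∈ Periodic (step (system A ×ˢ system X)) (a , x) ] suc (proj₁ per) ≤ numPeriodic B
pairPeriod≤ A X B σ ((a , ta) , (x , tx)) =
  period≤ (step AX) (Periodic-×ˢ (system A) (system X) (isPeriodic⇒Periodic A ta) (isPeriodic⇒Periodic X tx))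
          (λ k → periodicIndex B (Inverse.to σ (orbit k))) faithful
  where
    AX = system A ×ˢ system X
    orbit : ℕ → PeriodicState A × PeriodicState X
    orbit k = ((f A ^ k) a , isPeriodic-^ A ta k) , ((f X ^ k) x , isPeriodic-^ X tx k)
    faithful : ∀ k l → periodicIndex B (Inverse.to σ (orbit k)) ≡ periodicIndex B (Inverse.to σ (orbit l)) →
               (step AX ^ k) (a , x) ≡ (step AX ^ l) (a , x)
    faithful k l same =
      let orbit-k≡l = trans (sym (Inverse.strictlyInverseʳ σ (orbit k)))
                        (trans (cong (Inverse.from σ) (periodicIndex-injective B same)) (Inverse.strictlyInverseʳ σ (orbit l)))
      in trans (^-×ˢ (system A) (system X) k a x)
           (trans (cong (λ ((s , _) , (t , _)) → s , t) orbit-k≡l) (sym (^-×ˢ (system A) (system X) l a x)))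

proposition1 : (A X B : FDDS) (n : ℕ) →
               2 * numPeriodic B + depth B ≤ n →
               ((unroll A ⊗ unroll X) ≃ unroll B) ⇔ ((trunc n (unroll A) ⊗ trunc n (unroll X)) ≃ trunc n (unroll B))
proposition1 A X B n bound = mk⇔
  (λ (σ , τ) → σ , λ i → truncate-≅ᵗ A X B n (τ i))
  (λ (σ , τ) → σ , λ i →
     let perAX , perAX≤ = pairPeriod≤ A X B σ i
         perB  , perB≤  = statePeriod≤ B (Inverse.to σ i)
     in extend-≅ᵗ A X B n perAX perB (periods-fit perAX≤ perB≤) (τ i))
  where
    α = numPeriodic B
    periods-fit : ∀ {P P'} → P ≤ α → P' ≤ α → P + P' + depth B ≤ n
    periods-fit P≤α P'≤α = ≤-trans (+-monoˡ-≤ (depth B) (+-mono-≤ P≤α P'≤α))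
      (≤-trans (≤-reflexive (cong (λ m → α + m + depth B) (sym (+-identityʳ α)))) bound)
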